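{- Let $\mathcal{A}=(V,V_P,E,T)$ be a target arena and $\mu=(\mu_u)_{u\in V_N}$ a family of full-support probability distributions. If there is a path in $(V,E)$ from some vertex $v\in V$ to (a vertex of) $T$, then there is also a simple $\mu$-non-decreasing path from $v$ to $T$.
   Context: A target arena is a tuple $\mathcal{A}=(V,V_P,E,T)$ where $V$ is finite, $V_P\subseteq V$, $V_N:=V\setminus V_P$, $E\subseteq (V_P\times V_N)\cup(V_N\times V_P)$, $T\subseteq V_P$, and $uE:=\{v\mid (u,v)\in E\}\neq\emptyset$ for all $u\in V_N$. A family of full-support probability distributions is $\mu=(\mu_u)_{u\in V_N}$ with each $\mu_u:uE\to\mathbb{Q}_{>0}$ summing to $1$. A strategy is a function $\sigma:V_P\to V_N$. The arena, $\mu$ and $\sigma$ induce the Markov chain on $V_P\cup\{\bot\}$ in which from $p\in V_P$ the next state is $q$ with probability $\mu_{\sigma(p)}(q)$ if $(p,\sigma(p))\in E$, and $\bot$ with probability $1$ otherwise; $\bot$ is absorbing. $\mathrm{Val}^\mu(v):=\max_\sigma$ (probability of eventually reaching $T$ from $v$ in this chain) for $v\in V_P$, and $\mathrm{Val}^\mu(u):=\sum_{v\in uE}\mu_u(v)\mathrm{Val}^\mu(v)$ for $u\in V_N$. A path $v_0\dots v_k$ is $\mu$-non-decreasing if $\mathrm{Val}^\mu(v_i)\le\mathrm{Val}^\mu(v_{i+1})$ for all $0\le i<k$. -}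

module Defs where

open import Data.Nat using (ℕ; zero; suc)
open import Data.Fin using (Fin; zero; suc)
open import Data.Bool using (Bool; true; false; if_then_else_; not) renaming (T to True)
open import Data.Rational using (ℚ; 0ℚ; 1ℚ; _+_; _*_; _-_; _≤_; _<_)
open import Data.List using (List; []; _∷_)
open import Data.List.Relation.Unary.Linked using (Linked)
open import Data.List.Relation.Unary.Unique.Propositional using (Unique)
open import Data.Product using (Σ; ∃; _×_; _,_)
open import Data.Sum using (_⊎_)
open import Relation.Binary.PropositionalEquality using (_≡_)

sumFin : ∀ {n} → (Fin n → ℚ) → ℚ
sumFin {zero}  f = 0ℚ
sumFin {suc n} f = f zero + sumFin (λ i → f (suc i))

-- A target arena with vertex set V = Fin n.
-- isP v = true iff v ∈ V_P (V_N is the complement);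
-- edge u v = true iff (u , v) ∈ E;  target v = true iff v ∈ T.
record Arena (n : ℕ) : Set where
  field
    isP       : Fin n → Bool
    edge      : Fin n → Fin n → Bool
    target    : Fin n → Bool
    bipartite : ∀ u v → True (edge u v) →
                (True (isP u) × True (not (isP v))) ⊎ (True (not (isP u)) × True (isP v))
    target⊆P  : ∀ v → True (target v) → True (isP v)
    nonDead   : ∀ u → True (not (isP u)) → ∃ λ v → True (edge u v)

module _ {n : ℕ} (A : Arena n) where
  open Arena A

  restrict : (Fin n → Fin n → ℚ) → Fin n → Fin n → ℚ
  restrict μ u v = if edge u v then μ u v else 0ℚ

  -- μ = (μ_u)_{u ∈ V_N}: a family of full-support probability distributions
  -- μ_u : uE → ℚ_{>0} summing to 1 (values outside uE / for u ∈ V_P are irrelevant).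
  IsFullSupportFamily : (Fin n → Fin n → ℚ) → Set
  IsFullSupportFamily μ =
    ∀ u → True (not (isP u)) →
      (∀ v → True (edge u v) → 0ℚ < μ u v) × (sumFin (restrict μ u) ≡ 1ℚ)

  -- A strategy σ : V_P → V_N (represented as a function on Fin n whose values
  -- on V_P lie in V_N; its values on V_N are irrelevant).
  IsStrategy : (Fin n → Fin n) → Set
  IsStrategy σ = ∀ p → True (isP p) → True (not (isP (σ p)))

  -- Probability, in the Markov chain induced by σ, of reaching T within k steps
  -- starting from state p (⊥ never reaches T, so it contributes 0).
  reachWithin : (Fin n → Fin n → ℚ) → (Fin n → Fin n) → ℕ → Fin n → ℚ
  reachWithin μ σ zero    p = if target p then 1ℚ else 0ℚ
  reachWithin μ σ (suc k) p =
    if target p then 1ℚ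
    else (if edge p (σ p)
          then sumFin (λ q → restrict μ (σ p) q * reachWithin μ σ k q)
          else 0ℚ)

  IsReachProb : (Fin n → Fin n → ℚ) → (Fin n → Fin n) → Fin n → ℚ → Set
  IsReachProb μ σ p x =
    (∀ k → reachWithin μ σ k p ≤ x) ×
    (∀ ε → 0ℚ < ε → ∃ λ k → x - ε < reachWithin μ σ k p)

  IsMaxReach : (Fin n → Fin n → ℚ) → Fin n → ℚ → Set
  IsMaxReach μ p x =
    (∃ λ σ → IsStrategy σ × IsReachProb μ σ p x) ×
    (∀ σ → IsStrategy σ → ∀ k → reachWithin μ σ k p ≤ x)

  IsVal : (Fin n → Fin n → ℚ) → (Fin n → ℚ) → Set
  IsVal μ val =
    (∀ p → True (isP p) → IsMaxReach μ p (val p)) ×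
    (∀ u → True (not (isP u)) → val u ≡ sumFin (λ v → restrict μ u v * val v))

  lastOf : Fin n → List (Fin n) → Fin n
  lastOf v []       = v
  lastOf v (w ∷ vs) = lastOf w vs

  EdgeRel : Fin n → Fin n → Set
  EdgeRel u v = True (edge u v)

  IsPathToT : Fin n → List (Fin n) → Set
  IsPathToT v vs = Linked EdgeRel (v ∷ vs) × True (target (lastOf v vs))

  NonDecreasing : (Fin n → ℚ) → Fin n → List (Fin n) → Set
  NonDecreasing val v vs = Linked (λ a b → val a ≤ val b) (v ∷ vs)

  Simple : Fin n → List (Fin n) → Set
  Simple v vs = Unique (v ∷ vs)

module Submission where

-- Call a vertex good if it has a μ-non-decreasing path to T.  The proof shows
-- that every vertex with some path to T is good; cutting the cycles out of a
-- good path then yields the simple non-decreasing path of the theorem.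
--
-- Let S avoid T and let every
-- edge leaving a vertex of S enter S again or a vertex of value at most c,
-- where c ≥ 0.  Then no strategy reaches T from S with probability above c,
-- so every vertex of S has value at most c.  If some bad (= not good) vertex
-- had positive value, the bad vertices of maximal value M would form such a
-- trap for c the largest value below M; as c < M this is absurd, so all bad
-- vertices have value ≤ 0.  Now a path from a bad vertex v to T crosses an
-- edge a → b from a bad to a good vertex, and val a ≤ 0 ≤ val b would make a
-- good.  Hence v is good.  Goodness is decidable (simple witnesses are
-- shorter than n), which makes this argument by contradiction constructive.

open import Defs
open import Data.Nat using (ℕ; zero; suc; z≤n; s≤s) renaming (_≤_ to _≤ℕ_)
open import Data.Nat.Properties using () renaming (<⇒≤ to <⇒≤ℕ)
open import Data.Fin using (Fin; zero; suc)
open import Data.Fin.Properties using (any?; injective⇒≤) renaming (_≟_ to _≟Fin_)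
open import Data.Bool using (true; false; not) renaming (T to True)
open import Data.Bool.Properties using (T-≡)
open import Data.Rational using (ℚ; 0ℚ; 1ℚ; _+_; _*_; _-_; -_; _≤_; _<_; _⊔_; nonNegative)
open import Data.Rational.Properties
  using ( ≤-refl; ≤-trans; ≤-reflexive; <⇒≤; ≰⇒>; ≮⇒≥; <-irrefl; <-≤-trans; ≤-<-trans
        ; _≤?_; _<?_; +-mono-≤; +-monoˡ-<; +-inverseʳ; *-zeroˡ; *-identityˡ; *-distribʳ-+
        ; *-monoˡ-≤-nonNeg; nonNegative⁻¹; ⊔-sel; p≤p⊔q; p≤q⊔p )
open import Data.Rational.Solver using (module +-*-Solver)
open import Data.List using (List; []; _∷_; length; lookup)
open import Data.List.Relation.Unary.Linked as Linked using (Linked; [-]; _∷_)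
open import Data.List.Relation.Unary.All as All using ([])
open import Data.List.Relation.Unary.All.Properties using (¬Any⇒All¬)
open import Data.List.Relation.Unary.AllPairs using ([]; _∷_)
open import Data.List.Relation.Unary.Unique.Propositional using (Unique)
open import Data.List.Relation.Unary.Any using (here; there)
open import Data.List.Membership.Propositional using (_∈_)
open import Data.List.Membership.Propositional.Properties using (∈-lookup)
open import Data.Product using (∃; ∃₂; _×_; _,_; proj₁; proj₂)
open import Data.Sum using (_⊎_; inj₁; inj₂)
open import Data.Empty using (⊥-elim)
open import Data.Unit using (tt)
open import Function using (_∘_; Equivalence)
open import Function.Definitions using (Injective)
open import Relation.Nullary using (¬_; yes; no)
open import Relation.Nullary.Decidable using (_×-dec_; _⊎-dec_; ¬?; map′)
open import Relation.Nullary.Decidable.Core using (T?)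
open import Relation.Unary using (Pred) renaming (Decidable to Decidable¹)
open import Relation.Binary.Core using (Rel)
open import Relation.Binary.Definitions using (DecidableEquality) renaming (Decidable to Decidable₂)
open import Relation.Binary.PropositionalEquality using (_≡_; refl; sym; trans; cong; subst)

final : ∀ {a} {X : Set a} → X → List X → X
final x []       = x
final x (y ∷ ys) = final y ys

lastOf≡final : ∀ {n} (A : Arena n) x xs → lastOf A x xs ≡ final x xs
lastOf≡final A x []       = refl
lastOf≡final A x (y ∷ ys) = lastOf≡final A y ys

PathTo : ∀ {a r p} {X : Set a} → Rel X r → Pred X p → Pred X _
PathTo R P x = ∃ λ xs → Linked R (x ∷ xs) × P (final x xs)

extendPath : ∀ {a r p} {X : Set a} {R : Rel X r} {P : Pred X p} {x y} →
             R x y → PathTo R P y → PathTo R P x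
extendPath xRy (ys , path , end) = _ ∷ ys , xRy ∷ path , end

entryEdge : ∀ {a r s} {X : Set a} {R : Rel X r} {S : Pred X s} → Decidable¹ S →
            ∀ x xs → Linked R (x ∷ xs) → ¬ S x → S (final x xs) →
            ∃₂ λ a b → R a b × ¬ S a × S b
entryEdge S? x []       path       x∉S x∈S = ⊥-elim (x∉S x∈S)
entryEdge S? x (y ∷ ys) (xRy ∷ path) x∉S end with S? y
... | yes y∈S = x , y , xRy , x∉S , y∈S
... | no  y∉S = entryEdge S? y ys path y∉S end

module _ {a r} {X : Set a} (_≟_ : DecidableEquality X) {R : Rel X r} where
  open import Data.List.Membership.DecPropositional _≟_ using (_∈?_)

  SimpleShortcut : X → List X → Set _
  SimpleShortcut x xs =
    ∃ λ ws → Linked R (x ∷ ws) × Unique (x ∷ ws) × final x ws ≡ final x xs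

  suffixFrom : ∀ {x y ws} → x ∈ y ∷ ws → Linked R (y ∷ ws) → Unique (y ∷ ws) →
               SimpleShortcut x (y ∷ ws)
  suffixFrom (here refl) path simple = _ , path , simple , refl
  suffixFrom {ws = w ∷ ws} (there x∈) path (_ ∷ simple) =
    suffixFrom x∈ (Linked.tail path) simple

  removeCycles : ∀ x xs → Linked R (x ∷ xs) → SimpleShortcut x xs
  removeCycles x []       path          = [] , path , [] ∷ [] , refl
  removeCycles x (y ∷ ys) (xRy ∷ path) with removeCycles y ys path
  ... | ws , path′ , simple , sameEnd with x ∈? y ∷ ws
  ...   | yes x∈ = let zs , pathz , simplez , endz = suffixFrom x∈ path′ simple
                   in zs , pathz , simplez , trans endz sameEnd
  ...   | no  x∉ = y ∷ ws , xRy ∷ path′ , ¬Any⇒All¬ (y ∷ ws) x∉ ∷ simple , sameEnd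

lookup-injective : ∀ {a} {X : Set a} (xs : List X) → Unique xs → Injective _≡_ _≡_ (lookup xs)
lookup-injective (x ∷ xs) _            {zero}  {zero}  eq = refl
lookup-injective (x ∷ xs) (x∉ ∷ _)     {zero}  {suc j} eq = ⊥-elim (All.lookup x∉ (∈-lookup j) eq)
lookup-injective (x ∷ xs) (x∉ ∷ _)     {suc i} {zero}  eq = ⊥-elim (All.lookup x∉ (∈-lookup i) (sym eq))
lookup-injective (x ∷ xs) (_ ∷ unique)  {suc i} {suc j} eq =
  cong suc (lookup-injective xs unique eq)

unique⇒length≤ : ∀ {m} (xs : List (Fin m)) → Unique xs → length xs ≤ℕ m
unique⇒length≤ xs unique = injective⇒≤ (lookup-injective xs unique)

module _ {n r p} {R : Rel (Fin n) r} {P : Pred (Fin n) p}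
         (R? : Decidable₂ R) (P? : Decidable¹ P) where

  PathWithin : ℕ → Pred (Fin n) _
  PathWithin k x = ∃ λ xs → length xs ≤ℕ k × Linked R (x ∷ xs) × P (final x xs)

  pathWithin? : ∀ k → Decidable¹ (PathWithin k)
  pathWithin? zero    x = map′ emptyPath atStart (P? x)
    where
    emptyPath : P x → PathWithin zero x
    emptyPath px = [] , z≤n , [-] , px
    atStart : PathWithin zero x → P x
    atStart ([] , _ , _ , px) = px
  pathWithin? (suc k) x =
    map′ join split (P? x ⊎-dec any? λ y → R? x y ×-dec pathWithin? k y)
    where
    join : P x ⊎ (∃ λ y → R x y × PathWithin k y) → PathWithin (suc k) x
    join (inj₁ px)                                = [] , z≤n , [-] , px
    join (inj₂ (y , xRy , ys , len , path , end)) = y ∷ ys , s≤s len , xRy ∷ path , end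
    split : PathWithin (suc k) x → P x ⊎ (∃ λ y → R x y × PathWithin k y)
    split ([]     , _       , _          , px)   = inj₁ px
    split (y ∷ ys , s≤s len , xRy ∷ path , end) = inj₂ (y , xRy , ys , len , path , end)

  -- Path existence is decidable, since a simple path has fewer than n edges.
  path? : Decidable¹ (PathTo R P)
  path? x = map′ forget shorten (pathWithin? n x)
    where
    forget : PathWithin n x → PathTo R P x
    forget (xs , _ , path , end) = xs , path , end
    shorten : PathTo R P x → PathWithin n x
    shorten (xs , path , end) =
      let ws , path′ , simple , sameEnd = removeCycles _≟Fin_ x xs path
      in ws , <⇒≤ℕ (unique⇒length≤ (x ∷ ws) simple) , path′ , subst P (sym sameEnd) end

maximise : ∀ {m p} {P : Pred (Fin m) p} → Decidable¹ P → (f : Fin m → ℚ) →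
           (∀ y → ¬ P y) ⊎ ∃ λ z → P z × (∀ y → P y → f y ≤ f z)
maximise {zero}  P? f = inj₁ λ ()
maximise {suc m} P? f with maximise (P? ∘ suc) (f ∘ suc) | P? zero
... | inj₁ none | no ¬p₀ = inj₁ λ { zero → ¬p₀ ; (suc y) → none y }
... | inj₁ none | yes p₀ =
  inj₂ (zero , p₀ , λ { zero _ → ≤-refl ; (suc y) py → ⊥-elim (none y py) })
... | inj₂ (z , pz , max) | no ¬p₀ =
  inj₂ (suc z , pz , λ { zero p₀ → ⊥-elim (¬p₀ p₀) ; (suc y) → max y })
... | inj₂ (z , pz , max) | yes p₀ with f zero ≤? f (suc z)
...   | yes f₀≤ = inj₂ (suc z , pz , λ { zero _ → f₀≤ ; (suc y) → max y })
...   | no  f₀≰ = inj₂ (zero , p₀ , λ { zero _ → ≤-refl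
                                       ; (suc y) py → ≤-trans (max y py) (<⇒≤ (≰⇒> f₀≰)) })

-- Finitely many values leave a gap below any positive bound M: the values of f
-- below M are all at most some c with 0 ≤ c < M.
gapBelow : ∀ {m} (f : Fin m → ℚ) M → 0ℚ < M →
           ∃ λ c → 0ℚ ≤ c × c < M × (∀ y → f y < M → f y ≤ c)
gapBelow f M 0<M with maximise (λ y → f y <? M) f
... | inj₁ none = 0ℚ , ≤-refl , 0<M , λ y fy<M → ⊥-elim (none y fy<M)
... | inj₂ (z , fz<M , max) = f z ⊔ 0ℚ , p≤q⊔p (f z) 0ℚ , c<M (⊔-sel (f z) 0ℚ) ,
                                λ y fy<M → ≤-trans (max y fy<M) (p≤p⊔q (f z) 0ℚ)
  where
  c<M : f z ⊔ 0ℚ ≡ f z ⊎ f z ⊔ 0ℚ ≡ 0ℚ → f z ⊔ 0ℚ < M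
  c<M (inj₁ eq) = subst (_< M) (sym eq) fz<M
  c<M (inj₂ eq) = subst (_< M) (sym eq) 0<M

sumFin-mono : ∀ {k} (f g : Fin k → ℚ) → (∀ i → f i ≤ g i) → sumFin f ≤ sumFin g
sumFin-mono {zero}  f g f≤g = ≤-refl
sumFin-mono {suc k} f g f≤g =
  +-mono-≤ (f≤g zero) (sumFin-mono (f ∘ suc) (g ∘ suc) (f≤g ∘ suc))

sumFin-*ʳ : ∀ {k} (f : Fin k → ℚ) c → sumFin (λ i → f i * c) ≡ sumFin f * c
sumFin-*ʳ {zero}  f c = sym (*-zeroˡ c)
sumFin-*ʳ {suc k} f c =
  trans (cong (f zero * c +_) (sumFin-*ʳ (f ∘ suc) c)) (sym (*-distribʳ-+ c (f zero) _))

module ValueTheory {n : ℕ} (A : Arena n) (μ : Fin n → Fin n → ℚ)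
                   (fullSupport : IsFullSupportFamily A μ)
                   (val : Fin n → ℚ) (isVal : IsVal A μ val) where
  open Arena A

  P⊎N : ∀ v → True (isP v) ⊎ True (not (isP v))
  P⊎N v with isP v
  ... | true  = inj₁ tt
  ... | false = inj₂ tt

  N→P : ∀ {u r} → True (not (isP u)) → True (edge u r) → True (isP r)
  N→P {u} {r} uN ur with bipartite u r ur
  ... | inj₂ (_ , rP)  = rP
  ... | inj₁ (uP , _) with isP u
  ...   | true = ⊥-elim uN

  avg : Fin n → (Fin n → ℚ) → ℚ
  avg u f = sumFin (λ r → restrict A μ u r * f r)

  avg-mono : ∀ {u} → True (not (isP u)) → (f g : Fin n → ℚ) →
             (∀ r → True (edge u r) → f r ≤ g r) → avg u f ≤ avg u g
  avg-mono {u} uN f g f≤g = sumFin-mono _ _ term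
    where
    term : ∀ r → restrict A μ u r * f r ≤ restrict A μ u r * g r
    term r with edge u r in ur
    ... | true  = *-monoˡ-≤-nonNeg (μ u r)
                    {{nonNegative (<⇒≤ (proj₁ (fullSupport u uN) r (Equivalence.from T-≡ ur)))}}
                    (f≤g r (Equivalence.from T-≡ ur))
    ... | false = ≤-reflexive (trans (*-zeroˡ (f r)) (sym (*-zeroˡ (g r))))

  -- μ_u is a probability distribution, so constants average to themselves.
  avg-const : ∀ {u} → True (not (isP u)) → ∀ c → avg u (λ _ → c) ≡ c
  avg-const {u} uN c =
    trans (sumFin-*ʳ (restrict A μ u) c)
          (trans (cong (_* c) (proj₂ (fullSupport u uN))) (*-identityˡ c))

  avg≤ : ∀ {u} → True (not (isP u)) → (f : Fin n → ℚ) → ∀ c →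
         (∀ r → True (edge u r) → f r ≤ c) → avg u f ≤ c
  avg≤ uN f c f≤c = ≤-trans (avg-mono uN f (λ _ → c) f≤c) (≤-reflexive (avg-const uN c))

  avg≥ : ∀ {u} → True (not (isP u)) → (f : Fin n → ℚ) → ∀ c →
         (∀ r → True (edge u r) → c ≤ f r) → c ≤ avg u f
  avg≥ uN f c c≤f = ≤-trans (≤-reflexive (sym (avg-const uN c))) (avg-mono uN (λ _ → c) f c≤f)

  reach≤val : ∀ σ → IsStrategy A σ → ∀ k q → True (isP q) → reachWithin A μ σ k q ≤ val q
  reach≤val σ σ-strategy k q qP = proj₂ (proj₁ isVal q qP) σ σ-strategy k

  val≤ : ∀ q → True (isP q) → ∀ c →
         (∀ σ → IsStrategy A σ → ∀ k → reachWithin A μ σ k q ≤ c) → val q ≤ c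
  val≤ q qP c bound with val q ≤? c
  ... | yes valq≤c = valq≤c
  ... | no  valq≰c with proj₁ (proj₁ isVal q qP)
  ...   | σ , σ-strategy , _ , approx with approx (val q - c) gap
    where
    gap : 0ℚ < val q - c
    gap = subst (_< val q - c) (+-inverseʳ c) (+-monoˡ-< (- c) (≰⇒> valq≰c))
  ...     | k , close = ⊥-elim (<-irrefl refl
              (<-≤-trans (subst (_< reachWithin A μ σ k q) (cancel (val q) c) close)
                         (bound σ σ-strategy k)))
    where
    cancel : ∀ x y → x - (x - y) ≡ y
    cancel = +-*-Solver.solve 2 (λ x y → x :- (x :- y) := y) refl
      where open +-*-Solver

  -- Values are non-negative: a V_P-value bounds the 0-step reach probability,
  -- and a V_N-value is an average of V_P-values.
  valP≥0 : ∀ q → True (isP q) → 0ℚ ≤ val q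
  valP≥0 q qP with proj₁ (proj₁ isVal q qP)
  ... | σ , σ-strategy , _ = ≤-trans reach₀≥0 (reach≤val σ σ-strategy zero q qP)
    where
    reach₀≥0 : 0ℚ ≤ reachWithin A μ σ zero q
    reach₀≥0 with target q
    ... | true  = nonNegative⁻¹ 1ℚ
    ... | false = ≤-refl

  val≥0 : ∀ v → 0ℚ ≤ val v
  val≥0 v with P⊎N v
  ... | inj₁ vP = valP≥0 v vP
  ... | inj₂ vN = subst (0ℚ ≤_) (sym (proj₂ isVal v vN))
                        (avg≥ vN val 0ℚ λ r vr → valP≥0 r (N→P vN vr))

  record IsTrap (c : ℚ) (S : Fin n → Set) : Set where
    field
      avoidsT : ∀ q → S q → ¬ True (target q)
      exits   : ∀ x z → S x → True (edge x z) → S z ⊎ val z ≤ c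

  module Trap {c : ℚ} {S : Fin n → Set} (trap : IsTrap c S) (0≤c : 0ℚ ≤ c) where
    open IsTrap trap

    -- Trap vertices are not targets, so reachWithin unfolds one step there.
    notTarget : ∀ q → S q → target q ≡ false
    notTarget q qS with target q in qT
    ... | true  = ⊥-elim (avoidsT q qS (Equivalence.from T-≡ qT))
    ... | false = refl

    -- Starting in S, no strategy reaches T with probability above c: after a
    -- legal move from q the play is in S again or at a vertex of value ≤ c,
    -- and the next random step lands in S or at a vertex of value ≤ c.  The
    -- probability 0 at the horizon or after an illegal move is ≤ c as c ≥ 0.
    trap-bound : ∀ σ → IsStrategy A σ → ∀ k q → True (isP q) → S q →
                 reachWithin A μ σ k q ≤ c
    trap-bound σ σ-strategy zero    q qP qS rewrite notTarget q qS = 0≤c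
    trap-bound σ σ-strategy (suc k) q qP qS rewrite notTarget q qS with edge q (σ q) in legal
    ... | false = 0≤c
    ... | true with exits q (σ q) qS (Equivalence.from T-≡ legal)
    ...   | inj₁ uS = avg≤ uN (reachWithin A μ σ k) c successor
      where
      uN = σ-strategy q qP
      successor : ∀ r → True (edge (σ q) r) → reachWithin A μ σ k r ≤ c
      successor r ur with exits (σ q) r uS ur
      ... | inj₁ rS  = trap-bound σ σ-strategy k r (N→P uN ur) rS
      ... | inj₂ r≤c = ≤-trans (reach≤val σ σ-strategy k r (N→P uN ur)) r≤c
    ...   | inj₂ u≤c =
      ≤-trans (avg-mono uN _ val λ r ur → reach≤val σ σ-strategy k r (N→P uN ur))
              (subst (_≤ c) (proj₂ isVal (σ q) uN) u≤c)
      where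
      uN = σ-strategy q qP

    trapP-value : ∀ q → True (isP q) → S q → val q ≤ c
    trapP-value q qP qS = val≤ q qP c λ σ σ-strategy k → trap-bound σ σ-strategy k q qP qS

    trap-value : ∀ q → S q → val q ≤ c
    trap-value q qS with P⊎N q
    ... | inj₁ qP = trapP-value q qP qS
    ... | inj₂ qN = subst (_≤ c) (sym (proj₂ isVal q qN)) (avg≤ qN val c successor)
      where
      successor : ∀ r → True (edge q r) → val r ≤ c
      successor r qr with exits q r qS qr
      ... | inj₁ rS  = trapP-value r (N→P qN qr) rS
      ... | inj₂ r≤c = r≤c

  -- A decidable set avoiding T and closed under non-decreasing edges contains
  -- only vertices of value ≤ 0: otherwise its vertices of maximal value M form
  -- a c-trap for the largest value c below M, although they have value M > c.
  closedSet-value : (B : Fin n → Set) → Decidable¹ B → (∀ q → B q → ¬ True (target q)) →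
                    (∀ x z → B x → True (edge x z) → val x ≤ val z → B z) →
                    ∀ x → B x → val x ≤ 0ℚ
  closedSet-value B B? avoidsT closed x xB with maximise B? val
  ... | inj₁ none = ⊥-elim (none x xB)
  ... | inj₂ (m , mB , max) with val m ≤? 0ℚ
  ...   | yes M≤0 = ≤-trans (max x xB) M≤0
  ...   | no  M≰0 with gapBelow val (val m) (≰⇒> M≰0)
  ...     | c , 0≤c , c<M , belowM = ⊥-elim (<-irrefl refl (≤-<-trans M≤c c<M))
    where
    Top : Fin n → Set
    Top q = B q × val m ≤ val q

    topTrap : IsTrap c Top
    topTrap = record { avoidsT = λ q qTop → avoidsT q (proj₁ qTop) ; exits = exits }
      where
      exits : ∀ x z → Top x → True (edge x z) → Top z ⊎ val z ≤ c
      exits x z (xB , _) xz with val z <? val m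
      ... | yes z<M = inj₂ (belowM z z<M)
      ... | no  z≮M = inj₁ (closed x z xB xz (≤-trans (max x xB) (≮⇒≥ z≮M)) , ≮⇒≥ z≮M)

    M≤c : val m ≤ c
    M≤c = Trap.trap-value topTrap 0≤c m (mB , ≤-refl)

  NonDecEdge : Rel (Fin n) _
  NonDecEdge x y = True (edge x y) × val x ≤ val y

  Good : Fin n → Set
  Good = PathTo NonDecEdge (True ∘ target)

  good? : Decidable¹ Good
  good? = path? (λ x y → T? (edge x y) ×-dec (val x ≤? val y)) (T? ∘ target)

  -- Every vertex with a path to T has a non-decreasing path to T: otherwise
  -- the path crosses from a bad vertex a to a good vertex b, but
  -- val a ≤ 0 ≤ val b because the bad vertices form a closed set.
  reachable⇒good : ∀ v → PathTo (EdgeRel A) (True ∘ target) v → Good v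
  reachable⇒good v (vs , path , end) with good? v
  ... | yes vGood = vGood
  ... | no  vBad with entryEdge good? v vs path vBad ([] , [-] , end)
  ...   | a , b , ab , aBad , bGood =
    ⊥-elim (aBad (extendPath {P = True ∘ target} (ab , a≤b) bGood))
    where
    badClosed : ∀ x z → ¬ Good x → True (edge x z) → val x ≤ val z → ¬ Good z
    badClosed x z xBad xz x≤z zGood = xBad (extendPath {P = True ∘ target} (xz , x≤z) zGood)

    a≤b : val a ≤ val b
    a≤b = ≤-trans (closedSet-value (¬_ ∘ Good) (¬? ∘ good?)
                                   (λ q qBad qT → qBad ([] , [-] , qT)) badClosed a aBad)
                  (val≥0 b)

lemma5 : ∀ {n} (A : Arena n) (μ : Fin n → Fin n → ℚ) → IsFullSupportFamily A μ →
    (val : Fin n → ℚ) → IsVal A μ val →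
    (v : Fin n) → (∃ λ (vs : List (Fin n)) → IsPathToT A v vs) →
    ∃ λ (ws : List (Fin n)) →
    IsPathToT A v ws × Simple A v ws × NonDecreasing A val v ws
lemma5 A μ fullSupport val isVal v (vs , path , end) =
  let xs , nonDecPath , xsEnd = reachable⇒good v (vs , path , inT (lastOf≡final A v vs) end)
      ws , nonDecPath′ , simple , sameEnd = removeCycles _≟Fin_ v xs nonDecPath
      wsEnd = inT (sym (trans (lastOf≡final A v ws) sameEnd)) xsEnd
  in ws , (Linked.map proj₁ nonDecPath′ , wsEnd) , simple , Linked.map proj₂ nonDecPath′
  where
  open Arena A using (target)
  open ValueTheory A μ fullSupport val isVal using (reachable⇒good)

  inT : ∀ {x y} → x ≡ y → True (target x) → True (target y)
  inT = subst (True ∘ target)
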